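{- For every labelled logic program $P$ over a finite signature $\mathit{At}$, every stable model of $P$ is a justified model of $P$, i.e. $\mathit{SM}(P) \subseteq \mathit{JM}(P)$.
   Context: Fix a finite non-empty set $\mathit{At}$ of propositional atoms. A labelled rule $r$ has the form $\ell : p_1 \vee \dots \vee p_m \leftarrow q_1 \wedge \dots \wedge q_n \wedge \neg s_1 \wedge \dots \wedge \neg s_j \wedge \neg\neg t_1 \wedge \dots \wedge \neg\neg t_k$ with all $p_i,q_i,s_i,t_i\in\mathit{At}$ and $m,n,j,k\ge 0$. Its label is $\mathit{Lb}(r)=\ell$, its head $\mathit{Head}(r)$ is the disjunction $p_1\vee\dots\vee p_m$ with head atoms $H(r)=\{p_1,\dots,p_m\}$, its body $\mathit{Body}(r)$ is the whole conjunction on the right, its positive body is $\mathit{Body}^+(r)=q_1\wedge\dots\wedge q_n$ with atom set $B^+(r)=\{q_1,\dots,q_n\}$, and its negative body $\mathit{Body}^-(r)$ is the conjunction of the remaining literals; an empty disjunction is $\bot$ and an empty conjunction is $\top$. A labelled program $P$ is a set of labelled rules in which no label is repeated (different rules may share head and body); $\mathit{Lb}(P)$ is its set of labels. An interpretation is a set $I\subseteq\mathit{At}$; $I$ is a model of $P$ if $I$ classically satisfies $\mathit{Body}(r)\to\mathit{Head}(r)$ for every $r\in P$. The reduct is $P^I=\{\mathit{Lb}(r):\mathit{Head}(r)\leftarrow \mathit{Body}^+(r) \mid r\in P,\ I\models \mathit{Body}^-(r)\}$, and $I$ is a stable model of $P$ if $I$ is a $\subseteq$-minimal model of $P^I$;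 $\mathit{SM}(P)$ is the set of stable models. For an atom $p$, $\mathit{Sup}(I,P,p)=\{r\in P\mid p\in H(r),\ I\models\mathit{Body}(r)\}$. A support graph of a model $I$ of $P$ is a labelled directed graph $G=\langle I,E,\lambda\rangle$ with vertex set $I$, edges $E\subseteq I\times I$ and $\lambda:I\to\mathit{Lb}(P)$ such that (i) $\lambda$ is injective, and (ii) for every $p\in I$, the rule $r\in P$ with $\mathit{Lb}(r)=\lambda(p)$ satisfies $r\in\mathit{Sup}(I,P,p)$ and $B^+(r)=\{q\mid (q,p)\in E\}$. An explanation is an acyclic support graph. A model $I$ of $P$ is a justified model if it has at least one explanation under $P$; $\mathit{JM}(P)$ is the set of justified models. -}

module Defs where

open import Data.Nat using (ℕ; suc)
open import Data.Fin using (Fin)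
open import Data.Fin.Subset using (Subset; _∈_; _∉_; _⊆_)
open import Data.Fin.Subset.Properties using (_∈?_)
open import Data.List using (List; []; map; filter)
open import Data.List.Relation.Unary.All using (All; all?)
open import Data.List.Relation.Unary.Any using (Any)
open import Data.List.Relation.Unary.Unique.Propositional using (Unique)
import Data.List.Membership.Propositional as LM
open import Data.Product using (_×_; _,_; Σ; ∃)
open import Relation.Nullary using (¬_; Dec; yes; no)
open import Relation.Nullary.Decidable using (_×-dec_; ¬?)
open import Relation.Binary.PropositionalEquality using (_≡_)
open import Relation.Binary.Construct.Closure.Transitive using (TransClosure)
open import Function.Bundles using (_⇔_)

Label : Set
Label = ℕ

module _ (n : ℕ) where

  Atom : Set
  Atom = Fin (suc n)

  Interp : Set
  Interp = Subset (suc n)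

  -- ℓ : p₁ ∨ … ∨ pₘ ← q₁ ∧ … ∧ qₙ ∧ ¬s₁ ∧ … ∧ ¬sⱼ ∧ ¬¬t₁ ∧ … ∧ ¬¬tₖ
  record Rule : Set where
    constructor rule
    field
      label : Label
      head  : List Atom
      pos   : List Atom
      neg   : List Atom
      dneg  : List Atom

  open Rule public

  record Program : Set where
    constructor program
    field
      rules        : List Rule
      labelsUnique : Unique (map label rules)

  open Program public

  HeadHolds : Interp → Rule → Set
  HeadHolds I r = Any (_∈ I) (head r)

  PosHolds : Interp → Rule → Set
  PosHolds I r = All (_∈ I) (pos r)

  NegHolds : Interp → Rule → Set
  NegHolds I r = All (λ s → ¬ (s ∈ I)) (neg r) × All (λ t → ¬ ¬ (t ∈ I)) (dneg r)

  NegHolds? : (I : Interp) (r : Rule) → Dec (NegHolds I r)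
  NegHolds? I r = all? (λ s → ¬? (s ∈? I)) (neg r) ×-dec all? (λ t → ¬? (¬? (t ∈? I))) (dneg r)

  BodyHolds : Interp → Rule → Set
  BodyHolds I r = PosHolds I r × NegHolds I r

  ModelRules : List Rule → Interp → Set
  ModelRules rs I = ∀ r → r LM.∈ rs → BodyHolds I r → HeadHolds I r

  IsModel : Program → Interp → Set
  IsModel P I = ModelRules (rules P) I

  strip : Rule → Rule
  strip r = rule (label r) (head r) (pos r) [] []

  reduct : Interp → Program → List Rule
  reduct I P = map strip (filter (NegHolds? I) (rules P))

  IsStable : Program → Interp → Set
  IsStable P I = ModelRules (reduct I P) I
               × (∀ J → J ⊆ I → ModelRules (reduct I P) J → I ⊆ J)

  InSup : Interp → Program → Atom → Rule → Set
  InSup I P p r = r LM.∈ rules P × p LM.∈ head r × BodyHolds I r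

  -- Support graph ⟨I, E, λ⟩ of model I: E a finite edge set on I,
  -- λ : I → Lb(P) (given as a function on atoms, constrained on I).
  record SupportGraph (P : Program) (I : Interp) : Set where
    field
      edges     : List (Atom × Atom)
      edgesInI  : ∀ q p → (q , p) LM.∈ edges → q ∈ I × p ∈ I
      lab       : Atom → Label
      labInj    : ∀ p q → p ∈ I → q ∈ I → lab p ≡ lab q → p ≡ q
      support   : ∀ p → p ∈ I →
                  Σ Rule λ r → InSup I P p r × label r ≡ lab p
                             × (∀ q → (q LM.∈ pos r) ⇔ ((q , p) LM.∈ edges))

  open SupportGraph public

  Edge : ∀ {P I} → SupportGraph P I → Atom → Atom → Set
  Edge G q p = (q , p) LM.∈ edges G

  Acyclic : ∀ {P I} → SupportGraph P I → Set
  Acyclic G = ∀ p → ¬ TransClosure (Edge G) p p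

  record Explanation (P : Program) (I : Interp) : Set where
    field
      graph   : SupportGraph P I
      acyclic : Acyclic graph

  IsJustified : Program → Interp → Set
  IsJustified P I = IsModel P I × Explanation P I

-- Derive atoms one at a time: an atom p ∈ I may be added with a rule r ∈ P
-- whose negative body holds in I, whose positive body is already derived and
-- none of whose head atoms is derived yet; since I is a model of P^I, such a
-- rule always has a head atom in I to add.  When no rule applies, the derived
-- set is a model of P^I inside I, hence all of I by minimality.  Recording for
-- each atom the rule that derived it gives an explanation: edges point from
-- earlier to later atoms, so the graph is acyclic, and the fresh-head condition
-- makes every rule derive at most one atom, so labels are injective.
module Submission where

open import Defs
open import Data.Nat using (ℕ; zero; suc; _≤_; _<_; _+_; z≤n; s≤s)
open import Data.Nat.Properties using (≤-reflexive; ≤-refl; ≤-trans; <-trans; <-irrefl; m≤m+n; +-suc; m≤n⇒m≤1+n)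
open import Data.Fin using (Fin; _≟_)
import Data.Fin as Fin
open import Data.Fin.Properties using (injective⇒≤)
open import Data.Fin.Subset using (Subset; _∈_; _⊆_)
open import Data.List using (List; []; _∷_; map; concatMap; length; lookup)
open import Data.List.Properties using (length-map)
open import Data.List.Relation.Unary.All as All using (All; all?; []; _∷_)
open import Data.List.Relation.Unary.Any as Any using (Any; any?; here; there)
open import Data.List.Relation.Unary.All.Properties.Core using (¬Any⇒All¬)
open import Data.List.Relation.Unary.Unique.Propositional using (Unique; []; _∷_)
open import Data.List.Membership.Propositional using (find; lose) renaming (_∈_ to _∈ₗ_; _∉_ to _∉ₗ_)
open import Data.List.Membership.Propositional.Properties
  using (∈-map⁺; ∈-map⁻; ∈-filter⁺; ∈-filter⁻; ∈-concatMap⁺; ∈-concatMap⁻; ∈-lookup)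
import Data.List.Membership.DecPropositional as DecMembership
open import Data.Vec using (tabulate)
open import Data.Vec.Properties using (lookup∘tabulate; lookup⇒[]=; []=⇒lookup)
open import Data.Product using (_×_; _,_; ∃; proj₁; proj₂)
open import Data.Bool using (true; false; if_then_else_)
open import Data.Empty using (⊥-elim)
open import Relation.Nullary using (¬_; Dec; yes; no; does)
open import Relation.Nullary.Decidable using (_×-dec_; ¬?; dec-true; dec-false)
open import Relation.Binary.PropositionalEquality using (_≡_; _≢_; refl; sym; trans; cong; subst)
open import Relation.Binary.Construct.Closure.Transitive using (TransClosure; [_]; _∷_)
open import Function.Bundles using (_⇔_; mk⇔)

module _ {A : Set} where

  lookup-injective : {xs : List A} → Unique xs →
                     ∀ i j → lookup xs i ≡ lookup xs j → i ≡ j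
  lookup-injective (x≢ ∷ u) Fin.zero    Fin.zero    eq = refl
  lookup-injective (x≢ ∷ u) Fin.zero    (Fin.suc j) eq = ⊥-elim (All.lookup x≢ (∈-lookup j) eq)
  lookup-injective (x≢ ∷ u) (Fin.suc i) Fin.zero    eq = ⊥-elim (All.lookup x≢ (∈-lookup i) (sym eq))
  lookup-injective (x≢ ∷ u) (Fin.suc i) (Fin.suc j) eq = cong Fin.suc (lookup-injective u i j eq)

  unique-map⇒injective : {B : Set} {f : A → B} {xs : List A} → Unique (map f xs) →
                         ∀ {x y} → x ∈ₗ xs → y ∈ₗ xs → f x ≡ f y → x ≡ y
  unique-map⇒injective u (here refl) (here refl) eq = refl
  unique-map⇒injective {f = f} (fx≢ ∷ u) (here refl) (there y∈) eq = ⊥-elim (All.lookup fx≢ (∈-map⁺ f y∈) eq)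
  unique-map⇒injective {f = f} (fx≢ ∷ u) (there x∈) (here refl) eq = ⊥-elim (All.lookup fx≢ (∈-map⁺ f x∈) (sym eq))
  unique-map⇒injective (_ ∷ u) (there x∈) (there y∈) eq = unique-map⇒injective u x∈ y∈ eq

  acyclic-if-ranked : {R : A → A → Set} (rank : A → ℕ) →
                      (∀ {x y} → R x y → rank x < rank y) → ∀ x → ¬ TransClosure R x x
  acyclic-if-ranked {R} rank increasing x cycle = <-irrefl refl (along cycle)
    where
    along : ∀ {x y} → TransClosure R x y → rank x < rank y
    along [ xRy ]       = increasing xRy
    along (xRy ∷ yR⁺z) = <-trans (increasing xRy) (along yR⁺z)

unique⇒length≤ : ∀ {m} {xs : List (Fin m)} → Unique xs → length xs ≤ m
unique⇒length≤ u = injective⇒≤ (lookup-injective u _ _)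

_∈ₗ?_ : ∀ {m} (x : Fin m) xs → Dec (x ∈ₗ xs)
x ∈ₗ? xs = DecMembership._∈?_ _≟_ x xs

toSubset : ∀ {m} → List (Fin m) → Subset m
toSubset xs = tabulate (λ x → does (x ∈ₗ? xs))

∈-toSubset⁺ : ∀ {m} {x : Fin m} {xs} → x ∈ₗ xs → x ∈ toSubset xs
∈-toSubset⁺ {x = x} {xs} x∈ =
  lookup⇒[]= x _ (trans (lookup∘tabulate _ x) (dec-true (x ∈ₗ? xs) x∈))

∈-toSubset⁻ : ∀ {m} {x : Fin m} {xs} → x ∈ toSubset xs → x ∈ₗ xs
∈-toSubset⁻ {x = x} {xs} x∈ =
  witness (x ∈ₗ? xs) (trans (sym (lookup∘tabulate _ x)) ([]=⇒lookup x∈))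
  where
  witness : (d : Dec (x ∈ₗ xs)) → does d ≡ true → x ∈ₗ xs
  witness (yes x∈ₗ) _ = x∈ₗ
  witness (no _) ()

module Derivations (n : ℕ) (P : Program n) (I : Interp n) where

  ∈-reduct⁺ : ∀ {r} → r ∈ₗ rules P → NegHolds n I r → strip n r ∈ₗ reduct n I P
  ∈-reduct⁺ r∈P neg = ∈-map⁺ (strip n) (∈-filter⁺ (NegHolds? n I) r∈P neg)

  ∈-reduct⁻ : ∀ {r′} → r′ ∈ₗ reduct n I P →
              ∃ λ r → r ∈ₗ rules P × NegHolds n I r × r′ ≡ strip n r
  ∈-reduct⁻ r′∈ with ∈-map⁻ (strip n) r′∈
  ... | r , r∈ , refl with ∈-filter⁻ (NegHolds? n I) r∈
  ...   | r∈P , neg = r , r∈P , neg , refl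

  reduct-model⇒model : ModelRules n (reduct n I P) I → IsModel n P I
  reduct-model⇒model model r r∈P (pos , neg) = model (strip n r) (∈-reduct⁺ r∈P neg) (pos , [] , [])

  Entry : Set
  Entry = Atom n × Rule n

  atoms : List Entry → List (Atom n)
  atoms = map proj₁

  derived : List Entry → Interp n
  derived ds = toSubset (atoms ds)

  Applicable : List Entry → Rule n → Set
  Applicable ds r = NegHolds n I r × All (_∈ₗ atoms ds) (pos r) × All (_∉ₗ atoms ds) (head r)

  applicable? : ∀ ds r → Dec (Applicable ds r)
  applicable? ds r = NegHolds? n I r
                 ×-dec all? (_∈ₗ? atoms ds) (pos r)
                 ×-dec all? (λ h → ¬? (h ∈ₗ? atoms ds)) (head r)

  -- Entries are listed latest first.
  data Derivation : List Entry → Set where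
    []   : Derivation []
    step : ∀ {ds p r} → Derivation ds → r ∈ₗ rules P → Applicable ds r →
           p ∈ₗ head r → p ∈ I → Derivation ((p , r) ∷ ds)

  atoms⊆I : ∀ {ds p} → Derivation ds → p ∈ₗ atoms ds → p ∈ I
  atoms⊆I (step _ _ _ _ p∈I) (here refl) = p∈I
  atoms⊆I (step d _ _ _ _)   (there p∈)  = atoms⊆I d p∈

  fresh : ∀ {ds p r} → Derivation ((p , r) ∷ ds) → p ∉ₗ atoms ds
  fresh (step _ _ (_ , _ , heads-fresh) p∈head _) = All.lookup heads-fresh p∈head

  fresh-≢ : ∀ {ds a r p} → Derivation ((a , r) ∷ ds) → p ∈ₗ atoms ds → a ≢ p
  fresh-≢ d p∈ refl = fresh d p∈

  atoms-unique : ∀ {ds} → Derivation ds → Unique (atoms ds)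
  atoms-unique []                  = []
  atoms-unique d@(step d′ _ _ _ _) = All.tabulate (fresh-≢ d) ∷ atoms-unique d′

  length≤ : ∀ {ds} → Derivation ds → length ds ≤ suc n
  length≤ {ds} d = ≤-trans (≤-reflexive (sym (length-map proj₁ ds))) (unique⇒length≤ (atoms-unique d))

  entry-atom : ∀ {ds p r} → (p , r) ∈ₗ ds → p ∈ₗ atoms ds
  entry-atom = ∈-map⁺ proj₁

  entry-of : ∀ {ds p} → p ∈ₗ atoms ds → ∃ λ r → (p , r) ∈ₗ ds
  entry-of p∈ with ∈-map⁻ proj₁ p∈
  ... | (_ , r) , e∈ , refl = r , e∈

  entry-supports : ∀ {ds p r} → Derivation ds → (p , r) ∈ₗ ds → InSup n I P p r
  entry-supports (step d r∈P (neg , pos⊆ , _) p∈head _) (here refl) =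
    r∈P , p∈head , All.map (atoms⊆I d) pos⊆ , neg
  entry-supports (step d _ _ _ _) (there e∈) = entry-supports d e∈

  entry-pos⊆atoms : ∀ {ds p r} → Derivation ds → (p , r) ∈ₗ ds → All (_∈ₗ atoms ds) (pos r)
  entry-pos⊆atoms (step _ _ (_ , pos⊆ , _) _ _) (here refl) = All.map there pos⊆
  entry-pos⊆atoms (step d _ _ _ _)              (there e∈) = All.map there (entry-pos⊆atoms d e∈)

  entry-functional : ∀ {ds p r r′} → Derivation ds → (p , r) ∈ₗ ds → (p , r′) ∈ₗ ds → r ≡ r′
  entry-functional d                (here refl) (here refl) = refl
  entry-functional d                (here refl) (there e∈)  = ⊥-elim (fresh d (entry-atom e∈))
  entry-functional d                (there e∈)  (here refl) = ⊥-elim (fresh d (entry-atom e∈))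
  entry-functional (step d _ _ _ _) (there e∈)  (there e′∈) = entry-functional d e∈ e′∈

  used⇒inapplicable : ∀ {ds p r} → Derivation ds → (p , r) ∈ₗ ds → ¬ Applicable ds r
  used⇒inapplicable d e∈ (_ , _ , heads-fresh) =
    All.lookup heads-fresh (proj₁ (proj₂ (entry-supports d e∈))) (entry-atom e∈)

  rule-used-once : ∀ {ds p q r} → Derivation ds → (p , r) ∈ₗ ds → (q , r) ∈ₗ ds → p ≡ q
  rule-used-once d                  (here refl) (here refl) = refl
  rule-used-once (step d _ app _ _) (here refl) (there e∈)  = ⊥-elim (used⇒inapplicable d e∈ app)
  rule-used-once (step d _ app _ _) (there e∈)  (here refl) = ⊥-elim (used⇒inapplicable d e∈ app)
  rule-used-once (step d _ _ _ _)   (there e∈)  (there e′∈) = rule-used-once d e∈ e′∈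

  incoming : Entry → List (Atom n × Atom n)
  incoming (p , r) = map (_, p) (pos r)

  edgesOf : List Entry → List (Atom n × Atom n)
  edgesOf = concatMap incoming

  ∈-edgesOf⁺ : ∀ {ds p q r} → (p , r) ∈ₗ ds → q ∈ₗ pos r → (q , p) ∈ₗ edgesOf ds
  ∈-edgesOf⁺ e∈ q∈ = ∈-concatMap⁺ incoming (lose e∈ (∈-map⁺ (_, _) q∈))

  ∈-edgesOf⁻ : ∀ {ds p q} → (q , p) ∈ₗ edgesOf ds → ∃ λ r → (p , r) ∈ₗ ds × q ∈ₗ pos r
  ∈-edgesOf⁻ qp∈ with find (∈-concatMap⁻ incoming qp∈)
  ... | (_ , r) , e∈ , qp∈′ with ∈-map⁻ _ qp∈′
  ...   | _ , q∈ , refl = r , e∈ , q∈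

  rank : List Entry → Atom n → ℕ
  rank []             p = 0
  rank ((a , _) ∷ ds) p = if does (a ≟ p) then suc (length ds) else rank ds p

  rank≤length : ∀ ds p → rank ds p ≤ length ds
  rank≤length []             p = z≤n
  rank≤length ((a , _) ∷ ds) p with does (a ≟ p)
  ... | true  = ≤-refl
  ... | false = m≤n⇒m≤1+n (rank≤length ds p)

  rank-entry : ∀ {ds p q r} → Derivation ds → (p , r) ∈ₗ ds → q ∈ₗ pos r → rank ds q < rank ds p
  rank-entry {_ ∷ ds} {p} {q} d@(step _ _ (_ , pos⊆ , _) _ _) (here refl) q∈
    rewrite dec-false (p ≟ q) (fresh-≢ d (All.lookup pos⊆ q∈)) | dec-true (p ≟ p) refl
    = s≤s (rank≤length ds q)
  rank-entry {(a , _) ∷ _} {p} {q} d@(step d′ _ _ _ _) (there e∈) q∈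
    rewrite dec-false (a ≟ p) (fresh-≢ d (entry-atom e∈))
          | dec-false (a ≟ q) (fresh-≢ d (All.lookup (entry-pos⊆atoms d′ e∈) q∈))
    = rank-entry d′ e∈ q∈

  rank-increasing : ∀ {ds p q} → Derivation ds → (q , p) ∈ₗ edgesOf ds → rank ds q < rank ds p
  rank-increasing d qp∈ with ∈-edgesOf⁻ qp∈
  ... | _ , e∈ , q∈ = rank-entry d e∈ q∈

  -- The value 0 on underived atoms is junk and never inspected.
  labelOf : List Entry → Atom n → Label
  labelOf []             p = 0
  labelOf ((a , r) ∷ ds) p = if does (a ≟ p) then label r else labelOf ds p

  labelOf-entry : ∀ {ds p r} → Derivation ds → (p , r) ∈ₗ ds → labelOf ds p ≡ label r
  labelOf-entry {p = p} d (here refl) rewrite dec-true (p ≟ p) refl = refl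
  labelOf-entry {(a , _) ∷ _} {p} d@(step d′ _ _ _ _) (there e∈)
    rewrite dec-false (a ≟ p) (fresh-≢ d (entry-atom e∈)) = labelOf-entry d′ e∈

  labelOf-injective : ∀ {ds p q r r′} → Derivation ds → (p , r) ∈ₗ ds → (q , r′) ∈ₗ ds →
                      labelOf ds p ≡ labelOf ds q → p ≡ q
  labelOf-injective d e∈ e′∈ eq
    with unique-map⇒injective (labelsUnique P) (proj₁ (entry-supports d e∈)) (proj₁ (entry-supports d e′∈))
           (trans (sym (labelOf-entry d e∈)) (trans eq (labelOf-entry d e′∈)))
  ... | refl = rule-used-once d e∈ e′∈

  edges-into : ∀ {ds p r} → Derivation ds → (p , r) ∈ₗ ds →
               ∀ q → q ∈ₗ pos r ⇔ (q , p) ∈ₗ edgesOf ds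
  edges-into {ds} {p} {r} d e∈ q = mk⇔ (∈-edgesOf⁺ e∈) from
    where
    from : (q , p) ∈ₗ edgesOf ds → q ∈ₗ pos r
    from qp∈ with ∈-edgesOf⁻ qp∈
    ... | _ , e′∈ , q∈ with entry-functional d e∈ e′∈
    ...   | refl = q∈

  edges-in-I : ∀ {ds} → Derivation ds → ∀ q p → (q , p) ∈ₗ edgesOf ds → q ∈ I × p ∈ I
  edges-in-I d q p qp∈ with ∈-edgesOf⁻ qp∈
  ... | _ , e∈ , q∈ with entry-supports d e∈
  ...   | _ , _ , pos⊆I , _ = All.lookup pos⊆I q∈ , atoms⊆I d (entry-atom e∈)

  explanation : ∀ {ds} → Derivation ds → I ⊆ derived ds → Explanation n P I
  explanation {ds} d I⊆ = record
    { graph   = graph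
    ; acyclic = acyclic-if-ranked (rank ds) (rank-increasing d)
    }
    where
    entry : ∀ {p} → p ∈ I → ∃ λ r → (p , r) ∈ₗ ds
    entry p∈I = entry-of (∈-toSubset⁻ (I⊆ p∈I))

    graph : SupportGraph n P I
    graph = record
      { edges    = edgesOf ds
      ; edgesInI = edges-in-I d
      ; lab      = labelOf ds
      ; labInj   = λ p q p∈I q∈I → labelOf-injective d (proj₂ (entry p∈I)) (proj₂ (entry q∈I))
      ; support  = λ p p∈I → let r , e∈ = entry p∈I in
                   r , entry-supports d e∈ , sym (labelOf-entry d e∈) , edges-into d e∈
      }

  stuck⇒reduct-model : ∀ {ds} → ¬ Any (Applicable ds) (rules P) → ModelRules n (reduct n I P) (derived ds)
  stuck⇒reduct-model {ds} none r′ r′∈ (pos⊆ , _) with ∈-reduct⁻ r′∈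
  ... | r , r∈P , neg , refl with any? (_∈ₗ? atoms ds) (head r)
  ...   | yes h∈ = Any.map ∈-toSubset⁺ h∈
  ...   | no  h∉ = ⊥-elim (none (lose r∈P (neg , All.map ∈-toSubset⁻ pos⊆ , ¬Any⇒All¬ (head r) h∉)))

  extend : ModelRules n (reduct n I P) I → ∀ {ds} → Derivation ds →
           Any (Applicable ds) (rules P) → ∃ λ e → Derivation (e ∷ ds)
  extend model d some with find some
  ... | r , r∈P , app@(neg , pos⊆ , _)
      with find (reduct-model⇒model model r r∈P (All.map (atoms⊆I d) pos⊆ , neg))
  ...   | p , p∈head , p∈I = (p , r) , step d r∈P app p∈head p∈I

  saturate : ModelRules n (reduct n I P) I → ∀ {ds} (fuel : ℕ) → Derivation ds →
             suc n ≤ fuel + length ds →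
             ∃ λ ds′ → Derivation ds′ × ModelRules n (reduct n I P) (derived ds′)
  saturate model {ds} fuel d enough with any? (applicable? ds) (rules P)
  ... | no  none = ds , d , stuck⇒reduct-model none
  ... | yes some with extend model d some | fuel
  ...   | _ , d′ | zero      = ⊥-elim (<-irrefl refl (≤-trans (length≤ d′) enough))
  ...   | _ , d′ | suc fuel′ =
          saturate model fuel′ d′ (subst (suc n ≤_) (sym (+-suc fuel′ (length ds))) enough)

theorem1 : (n : ℕ) (P : Program n) (I : Interp n) → IsStable n P I → IsJustified n P I
theorem1 n P I (model , minimal) =
  let open Derivations n P I
      ds , d , saturated = saturate model (suc n) [] (m≤m+n (suc n) 0)
      I⊆derived = minimal (derived ds) (λ p∈ → atoms⊆I d (∈-toSubset⁻ p∈)) saturated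
  in reduct-model⇒model model , explanation d I⊆derived
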